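{- If an $\mathrm{SCCD}(v,k,b)$ with excess $e$ and an outer expansion set exists, then an $\mathrm{SCCD}(v+2,k,b')$ with $b'=b+\frac{2v}{k-1}+1$ exists with excess $e+k-2$.
   Context: An $\mathrm{SCCD}(v,k,b)$ (linear single change covering design) is a $v$-set $X$ with an ordered list $(B_1,\dots,B_b)$ of $k$-subsets of $X$ with $|B_i\cap B_{i+1}|=k-1$ for $1\le i<b$, such that every pair of elements of $X$ is contained in some block. Its excess is $e=(k-1)b+\binom{k-1}{2}-\binom{v}{2}$. The unchanged subsets are $U_i=B_i\cap B_{i+1}$ for $1\le i\le b-1$; in addition $U_0$ may be any $(k-1)$-subset of $B_1$ and $U_b$ any $(k-1)$-subset of $B_b$. An expansion set is a collection of $\frac{v}{k-1}$ unchanged subsets (distinct indices in $\{0,\dots,b\}$) that are pairwise disjoint with union $X$; it is outer if it contains $U_0$ or $U_b$. -}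

module Defs where

open import Data.Nat using (ℕ; zero; suc; _+_; _*_; _∸_; _<_; _≤_; pred; NonZero)
open import Data.Nat.Properties using (<-trans; n<1+n)
open import Data.Nat.Combinatorics using (_C_)
open import Data.Nat.DivMod using (_/_)
open import Data.Integer using (ℤ; +_; _-_)
open import Data.Fin using (Fin; fromℕ<; toℕ)
open import Data.Fin.Subset using (Subset; _∩_; _⊆_; _∈_; ∣_∣; Empty)
open import Data.Product using (Σ; ∃; _×_)
open import Data.Sum using (_⊎_)
open import Function.Definitions using (Injective)
open import Relation.Binary.PropositionalEquality using (_≡_; _≢_)

-- A linear single change covering design SCCD(v,k,b) on X = Fin v.
-- Blocks B_1..B_b are indexed 0..b-1 (Fin b).
record SCCD (v k b : ℕ) : Set where
  field
    block       : Fin b → Subset v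
    blockSize   : ∀ i → ∣ block i ∣ ≡ k
    singleChange : ∀ (i : ℕ) (p : suc i < b) →
      ∣ block (fromℕ< (<-trans (n<1+n i) p)) ∩ block (fromℕ< p) ∣ ≡ k ∸ 1
    covering    : ∀ (x y : Fin v) → x ≢ y → ∃ λ i → x ∈ block i × y ∈ block i
open SCCD public

excess : ℕ → ℕ → ℕ → ℤ
excess v k b = + ((k ∸ 1) * b + ((k ∸ 1) C 2)) - + (v C 2)

-- Unchanged j S : S is a permissible choice of the unchanged subset U_j
-- (j ∈ {0,…,b}, paper indexing).
data Unchanged {v k b : ℕ} (D : SCCD v k b) : ℕ → Subset v → Set where
  u-first : ∀ {S} (p : 0 < b) → S ⊆ block D (fromℕ< p) → ∣ S ∣ ≡ k ∸ 1 →
            Unchanged D 0 S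
  u-last  : ∀ {S} (p : pred b < b) → S ⊆ block D (fromℕ< p) → ∣ S ∣ ≡ k ∸ 1 →
            Unchanged D b S
  u-mid   : ∀ {S} (i : ℕ) (p : suc i < b) →
            S ≡ block D (fromℕ< (<-trans (n<1+n i) p)) ∩ block D (fromℕ< p) →
            Unchanged D (suc i) S

record ExpansionSet {v k b : ℕ} (D : SCCD v k b) : Set where
  field
    size      : ℕ
    sizeEq    : size * (k ∸ 1) ≡ v
    index     : Fin size → ℕ
    subset    : Fin size → Subset v
    isUnch    : ∀ a → Unchanged D (index a) (subset a)
    distinct  : Injective _≡_ _≡_ index
    disjoint  : ∀ a c → a ≢ c → Empty (subset a ∩ subset c)
    covers    : ∀ (x : Fin v) → ∃ λ a → x ∈ subset a

Outer : ∀ {v k b} {D : SCCD v k b} → ExpansionSet D → Set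
Outer {b = b} E = ∃ λ a → ExpansionSet.index E a ≡ 0 ⊎ ExpansionSet.index E a ≡ b

-- Add two points ∞₁, ∞₂. Keep the old blocks B₁, …, B_b in order and, for every unchanged
-- subset U_j of the expansion set, insert U_j ∪ {∞₁}, U_j ∪ {∞₂} where U_j sits. Since
-- U_j ⊆ B_j ∩ B_{j+1} and |U_j| = k - 1, consecutive blocks still share k - 1 points, and since
-- the U_j partition X, every pair {x, ∞ᵢ} is covered. The pair {∞₁, ∞₂} is covered by one more
-- block W ∪ {∞₁, ∞₂} with W a (k - 2)-subset of the outer U_0 (resp. U_b); it meets U ∪ {∞ᵢ} in
-- k - 1 points, so it can be put at the front (resp. back) of the sequence. This adds
-- 2v/(k - 1) + 1 blocks and (2v/(k - 1) + 1)(k - 1) - (2v + 1) = k - 2 to the excess.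

module Submission where

open import Defs
open import Data.Nat using (ℕ; _+_; _*_; _∸_; NonZero)
open import Data.Nat.DivMod using (_/_)
open import Data.Integer using (+_)
open import Data.Product using (Σ; ∃; _×_)
open import Relation.Binary.PropositionalEquality using (_≡_)
import Data.Integer as ℤ

open import Data.Bool using (true; false; if_then_else_)
open import Data.Nat using (zero; suc; pred; _<_; _≤_; _≡ᵇ_; z≤n; s≤s)
open import Data.Nat.Properties using (_≟_; +-identityʳ; +-comm; *-suc; *-assoc; <-trans; n<1+n; <-irrefl; ≤-refl; <⇒≤)
open import Data.Nat.DivMod using (m*n/n≡m)
open import Data.Nat.Combinatorics using (_C_; nCk+nC[k+1]≡[n+1]C[k+1]; nC1≡n)
open import Data.Nat.ListAction using (sum)
import Data.Nat.Tactic.RingSolver as ℕ-Solver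
open import Data.Integer using (_-_)
open import Data.Integer.Properties using (pos-+)
import Data.Integer.Tactic.RingSolver as ℤ-Solver
open import Data.Fin using (Fin; zero; suc; fromℕ<; _↑ˡ_; _↑ʳ_; splitAt)
open import Data.Fin.Properties using (splitAt⁻¹-↑ˡ; splitAt⁻¹-↑ʳ)
open import Data.Fin.Subset using (Subset; _∩_; _⊆_; _∈_; ∣_∣; inside; outside; ⊥; ⊤; ⁅_⁆)
open import Data.Fin.Subset.Properties using (⊆-refl; ⊆-antisym; p∩q⊆p; p∩q⊆q; x∈p∩q⁺; out⊆; ∩-comm; ∈⊤; x∈⁅x⁆; ∣⁅x⁆∣≡1)
open import Data.Vec using ([]; _∷_; here; there) renaming (_++_ to _++ᵛ_)
open import Data.Vec.Properties using (zipWith-++)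
open import Data.List using (List; []; _∷_; [_]; _++_; length; lookup; filter; concatMap; applyUpTo; allFin)
open import Data.List.Properties using (length-++; ++-assoc; ++-identityʳ; length-tabulate)
open import Data.List.Membership.Propositional using (lose) renaming (_∈_ to _∈ₗ_)
open import Data.List.Membership.Propositional.Properties using (∈-++⁺ˡ; ∈-++⁺ʳ; ∈-lookup; ∈-filter⁺; ∈-allFin; ∈-concat⁺′; ∈-map⁺)
open import Data.List.Relation.Unary.All using (All; []; _∷_; universal)
import Data.List.Relation.Unary.All as All
open import Data.List.Relation.Unary.All.Properties using (++⁺; concat⁺; map⁺; all-filter)
open import Data.List.Relation.Unary.Any using (Any; here; there)
import Data.List.Relation.Unary.Any as Any
open import Data.List.Relation.Unary.Any.Properties using (lookup-index)
open import Data.List.Relation.Unary.Linked using (Linked; [-]; _∷_)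
open import Data.List.Relation.Unary.AllPairs using (_∷_)
open import Data.List.Relation.Unary.Unique.Propositional using (Unique)
open import Data.List.Relation.Unary.Unique.Propositional.Properties using (filter⁺; allFin⁺)
open import Data.Product using (_,_; proj₁; proj₂; swap)
open import Data.Sum using (_⊎_; inj₁; inj₂)
open import Data.Empty using (⊥-elim)
open import Function using (_∘_; id; case_of_)
open import Function.Definitions using (Injective)
open import Relation.Nullary using (¬_)
open import Relation.Binary.PropositionalEquality using (_≢_; refl; sym; trans; cong; cong₂; subst; module ≡-Reasoning)

weave : ∀ {A : Set} n → (Fin n → A) → (ℕ → List A) → List A
weave zero    x g = g 0
weave (suc n) x g = g 0 ++ x zero ∷ weave n (x ∘ suc) (g ∘ suc)

module _ {A : Set} where

  ∈-weave-block : ∀ n (x : Fin n → A) g i → x i ∈ₗ weave n x g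
  ∈-weave-block (suc n) x g zero    = ∈-++⁺ʳ (g 0) (here refl)
  ∈-weave-block (suc n) x g (suc i) = ∈-++⁺ʳ (g 0) (there (∈-weave-block n (x ∘ suc) (g ∘ suc) i))

  ∈-weave-gap : ∀ n (x : Fin n → A) g {j y} → j ≤ n → y ∈ₗ g j → y ∈ₗ weave n x g
  ∈-weave-gap zero    x g {zero}  _         y∈ = y∈
  ∈-weave-gap (suc n) x g {zero}  _         y∈ = ∈-++⁺ˡ y∈
  ∈-weave-gap (suc n) x g {suc j} (s≤s j≤n) y∈ =
    ∈-++⁺ʳ (g 0) (there (∈-weave-gap n (x ∘ suc) (g ∘ suc) j≤n y∈))

  all-weave : ∀ {P : A → Set} n {x : Fin n → A} {g} → (∀ i → P (x i)) → (∀ j → All P (g j)) →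
              All P (weave n x g)
  all-weave zero    px pg = pg 0
  all-weave (suc n) px pg = ++⁺ (pg 0) (px zero ∷ all-weave n (px ∘ suc) (pg ∘ suc))

  length-weave : ∀ n (x : Fin n → A) g → length (weave n x g) ≡ n + sum (applyUpTo (length ∘ g) (suc n))
  length-weave zero    x g = sym (+-identityʳ (length (g 0)))
  length-weave (suc n) x g = begin
      length (g 0 ++ x zero ∷ weave n (x ∘ suc) (g ∘ suc))
    ≡⟨ length-++ (g 0) ⟩
      length (g 0) + suc (length (weave n (x ∘ suc) (g ∘ suc)))
    ≡⟨ cong (λ l → length (g 0) + suc l) (length-weave n (x ∘ suc) (g ∘ suc)) ⟩
      length (g 0) + suc (n + sum (applyUpTo (length ∘ g ∘ suc) (suc n)))
    ≡⟨ shuffle (length (g 0)) n _ ⟩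
      suc n + (length (g 0) + sum (applyUpTo (length ∘ g ∘ suc) (suc n)))
    ∎
    where
    open ≡-Reasoning
    shuffle : ∀ a n s → a + suc (n + s) ≡ suc n + (a + s)
    shuffle = ℕ-Solver.solve-∀

module _ {A : Set} {R : A → A → Set} where

  linked-++-∷ : ∀ xs {y ys} → Linked R (xs ++ [ y ]) → Linked R (y ∷ ys) → Linked R (xs ++ y ∷ ys)
  linked-++-∷ []            _         l = l
  linked-++-∷ (x ∷ [])      (r ∷ _)   l = r ∷ l
  linked-++-∷ (x ∷ x′ ∷ xs) (r ∷ l′)  l = r ∷ linked-++-∷ (x′ ∷ xs) l′ l

  linked-lookup : ∀ {xs} → Linked R xs → ∀ i (p : suc i < length xs) →
                  R (lookup xs (fromℕ< (<-trans (n<1+n i) p))) (lookup xs (fromℕ< p))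
  linked-lookup [-]      zero    (s≤s ())
  linked-lookup (r ∷ _)  zero    _       = r
  linked-lookup (_ ∷ rs) (suc i) (s≤s p) = linked-lookup rs i p

  InnerGapsLinked : ∀ n → (Fin (suc n) → A) → (ℕ → List A) → Set
  InnerGapsLinked n x g =
    ∀ i (p : suc i < suc n) → Linked R (x (fromℕ< (<-trans (n<1+n i) p)) ∷ g (suc i) ++ [ x (fromℕ< p) ])

  linked-∷-weave : ∀ n {x : Fin (suc n) → A} {g : ℕ → List A} post →
    InnerGapsLinked n x g →
    Linked R (x (fromℕ< (n<1+n n)) ∷ g (suc n) ++ post) →
    Linked R (x zero ∷ weave n (x ∘ suc) (g ∘ suc) ++ post)
  linked-∷-weave zero    post mid last = last
  linked-∷-weave (suc n) {x} {g} post mid last =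
    subst (λ l → Linked R (x zero ∷ l)) (sym (++-assoc (g 1) (x (suc zero) ∷ rest) post))
      (linked-++-∷ (x zero ∷ g 1) (mid 0 (s≤s (s≤s z≤n)))
        (linked-∷-weave n {x ∘ suc} {g ∘ suc} post (λ i p → mid (suc i) (s≤s p)) last))
    where
    rest : List A
    rest = weave n (λ i → x (suc (suc i))) (λ j → g (suc (suc j)))

  linked-weave : ∀ n {x : Fin (suc n) → A} {g : ℕ → List A} pre post →
    Linked R (pre ++ g 0 ++ [ x zero ]) →
    InnerGapsLinked n x g →
    Linked R (x (fromℕ< (n<1+n n)) ∷ g (suc n) ++ post) →
    Linked R (pre ++ weave (suc n) x g ++ post)
  linked-weave n {x} {g} pre post first mid last =
    subst (Linked R) (reassociate pre (g 0) (x zero ∷ weave n (x ∘ suc) (g ∘ suc)) post)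
      (linked-++-∷ (pre ++ g 0) (subst (Linked R) (sym (++-assoc pre (g 0) [ x zero ])) first)
        (linked-∷-weave n {x} {g} post mid last))
    where
    reassociate : ∀ as bs cs ds → (as ++ bs) ++ cs ++ ds ≡ as ++ (bs ++ cs) ++ ds
    reassociate as bs cs ds = trans (++-assoc as bs (cs ++ ds)) (cong (as ++_) (sym (++-assoc bs cs ds)))

sum-applyUpTo-0 : ∀ n → sum (applyUpTo (λ _ → 0) n) ≡ 0
sum-applyUpTo-0 zero    = refl
sum-applyUpTo-0 (suc n) = sum-applyUpTo-0 n

sum-applyUpTo-+ : ∀ {f g h : ℕ → ℕ} n → (∀ j → f j ≡ g j + h j) →
                  sum (applyUpTo f n) ≡ sum (applyUpTo g n) + sum (applyUpTo h n)
sum-applyUpTo-+ zero    _ = refl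
sum-applyUpTo-+ {f} {g} {h} (suc n) f≡g+h = begin
    f 0 + sum (applyUpTo (f ∘ suc) n)
  ≡⟨ cong₂ _+_ (f≡g+h 0) (sum-applyUpTo-+ n (f≡g+h ∘ suc)) ⟩
    (g 0 + h 0) + (sum (applyUpTo (g ∘ suc) n) + sum (applyUpTo (h ∘ suc) n))
  ≡⟨ interchange (g 0) (h 0) _ _ ⟩
    (g 0 + sum (applyUpTo (g ∘ suc) n)) + (h 0 + sum (applyUpTo (h ∘ suc) n))
  ∎
  where
  open ≡-Reasoning
  interchange : ∀ a b c d → (a + b) + (c + d) ≡ (a + c) + (b + d)
  interchange = ℕ-Solver.solve-∀

sum-applyUpTo-indicator : ∀ {c n} m → c < n → sum (applyUpTo (λ j → if c ≡ᵇ j then m else 0) n) ≡ m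
sum-applyUpTo-indicator {zero}  {suc n} m _         =
  trans (cong (λ s → m + s) (sum-applyUpTo-0 n)) (+-identityʳ m)
sum-applyUpTo-indicator {suc c} {suc n} m (s≤s c<n) = sum-applyUpTo-indicator m c<n

module _ {A : Set} (key : A → ℕ) where

  keyed : ℕ → List A → List A
  keyed j = filter (λ a → key a ≟ j)

  -- filter branches on does (key x ≟ j), which reduces to key x ≡ᵇ j.
  length-concatMap-keyed-∷ : ∀ {B : Set} (f : A → List B) j x xs →
    length (concatMap f (keyed j (x ∷ xs)))
      ≡ (if key x ≡ᵇ j then length (f x) else 0) + length (concatMap f (keyed j xs))
  length-concatMap-keyed-∷ f j x xs with key x ≡ᵇ j
  ... | true  = length-++ (f x)
  ... | false = refl

  sum-length-concatMap-keyed : ∀ {B : Set} (f : A → List B) n xs → All (λ x → key x < n) xs →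
    sum (applyUpTo (λ j → length (concatMap f (keyed j xs))) n) ≡ length (concatMap f xs)
  sum-length-concatMap-keyed f n []       _             = sum-applyUpTo-0 n
  sum-length-concatMap-keyed f n (x ∷ xs) (x<n ∷ xs<n) = begin
      sum (applyUpTo (λ j → length (concatMap f (keyed j (x ∷ xs)))) n)
    ≡⟨ sum-applyUpTo-+ n (λ j → length-concatMap-keyed-∷ f j x xs) ⟩
      sum (applyUpTo (λ j → if key x ≡ᵇ j then length (f x) else 0) n)
        + sum (applyUpTo (λ j → length (concatMap f (keyed j xs))) n)
    ≡⟨ cong₂ _+_ (sum-applyUpTo-indicator (length (f x)) x<n) (sum-length-concatMap-keyed f n xs xs<n) ⟩
      length (f x) + length (concatMap f xs)
    ≡⟨ length-++ (f x) ⟨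
      length (concatMap f (x ∷ xs))
    ∎
    where open ≡-Reasoning

  unique-on-key : Injective _≡_ _≡_ key → ∀ {j ys} → Unique ys → All (λ y → key y ≡ j) ys →
                  ys ≡ [] ⊎ ∃ λ y → ys ≡ [ y ] × key y ≡ j
  unique-on-key inj {ys = []}         _                _              = inj₁ refl
  unique-on-key inj {ys = y ∷ []}     _                (ky ∷ _)       = inj₂ (y , refl , ky)
  unique-on-key inj {ys = y ∷ y′ ∷ _} ((y≢y′ ∷ _) ∷ _) (ky ∷ ky′ ∷ _) =
    ⊥-elim (y≢y′ (inj (trans ky (sym ky′))))

∣++∣ : ∀ {m n} (X : Subset m) (t : Subset n) → ∣ X ++ᵛ t ∣ ≡ ∣ X ∣ + ∣ t ∣
∣++∣ []            t = refl
∣++∣ (inside ∷ X)  t = cong suc (∣++∣ X t)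
∣++∣ (outside ∷ X) t = ∣++∣ X t

∣++∩++∣ : ∀ {m n} (X Y : Subset m) (s t : Subset n) →
          ∣ (X ++ᵛ s) ∩ (Y ++ᵛ t) ∣ ≡ ∣ X ∩ Y ∣ + ∣ s ∩ t ∣
∣++∩++∣ X Y s t = trans (cong ∣_∣ (zipWith-++ _ X s Y t)) (∣++∣ (X ∩ Y) (s ∩ t))

⊆⇒∩≡ : ∀ {n} {X Y : Subset n} → X ⊆ Y → X ∩ Y ≡ X
⊆⇒∩≡ {X = X} {Y} X⊆Y = ⊆-antisym (p∩q⊆p X Y) (λ x∈X → x∈p∩q⁺ (x∈X , X⊆Y x∈X))

∣++∩++∣-⊆ˡ : ∀ {m n} {X Y : Subset m} (s t : Subset n) → X ⊆ Y →
             ∣ (X ++ᵛ s) ∩ (Y ++ᵛ t) ∣ ≡ ∣ X ∣ + ∣ s ∩ t ∣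
∣++∩++∣-⊆ˡ {X = X} {Y} s t X⊆Y =
  trans (∣++∩++∣ X Y s t) (cong (λ Z → ∣ Z ∣ + ∣ s ∩ t ∣) (⊆⇒∩≡ X⊆Y))

∣++∩++∣-⊆ʳ : ∀ {m n} {X Y : Subset m} (s t : Subset n) → Y ⊆ X →
             ∣ (X ++ᵛ s) ∩ (Y ++ᵛ t) ∣ ≡ ∣ Y ∣ + ∣ s ∩ t ∣
∣++∩++∣-⊆ʳ {X = X} {Y} s t Y⊆X =
  trans (∣++∩++∣ X Y s t) (cong (λ Z → ∣ Z ∣ + ∣ s ∩ t ∣) (trans (∩-comm X Y) (⊆⇒∩≡ Y⊆X)))

↑ˡ-∈ : ∀ {m n} {X : Subset m} {x} (t : Subset n) → x ∈ X → x ↑ˡ n ∈ X ++ᵛ t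
↑ˡ-∈ t here        = here
↑ˡ-∈ t (there x∈X) = there (↑ˡ-∈ t x∈X)

↑ʳ-∈ : ∀ {m n} (X : Subset m) {t : Subset n} {i} → i ∈ t → m ↑ʳ i ∈ X ++ᵛ t
↑ʳ-∈ []      i∈t = i∈t
↑ʳ-∈ (_ ∷ X) i∈t = there (↑ʳ-∈ X i∈t)

∃⊆-one-smaller : ∀ {n m} (X : Subset n) → ∣ X ∣ ≡ suc m → ∃ λ W → W ⊆ X × ∣ W ∣ ≡ m
∃⊆-one-smaller (inside  ∷ X) ∣X∣≡1+m = outside ∷ X , out⊆ (λ x∈X → x∈X) , cong pred ∣X∣≡1+m
∃⊆-one-smaller (outside ∷ X) ∣X∣≡1+m with ∃⊆-one-smaller X ∣X∣≡1+m
... | W , W⊆X , ∣W∣≡m = outside ∷ W , out⊆ W⊆X , ∣W∣≡m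

data Point (v : ℕ) : Fin (v + 2) → Set where
  old : ∀ x → Point v (x ↑ˡ 2)
  new : ∀ i → Point v (v ↑ʳ i)

point : ∀ v p → Point v p
point v p with splitAt v p in eq
... | inj₁ x = subst (Point v) (splitAt⁻¹-↑ˡ eq) (old x)
... | inj₂ i = subst (Point v) (splitAt⁻¹-↑ʳ eq) (new i)

Adjacent : ∀ {n} → ℕ → Subset n → Subset n → Set
Adjacent k X Y = ∣ X ∩ Y ∣ ≡ k ∸ 1

fromLinked : ∀ {n k} (L : List (Subset n)) → Linked (Adjacent k) L → All (λ B → ∣ B ∣ ≡ k) L →
             (∀ x y → x ≢ y → Any (λ B → x ∈ B × y ∈ B) L) → SCCD n k (length L)
fromLinked L linked sizes covers = record
  { block        = lookup L
  ; blockSize    = λ i → All.lookup sizes (∈-lookup i)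
  ; singleChange = linked-lookup linked
  ; covering     = λ x y x≢y → let found = covers x y x≢y in Any.index found , lookup-index found
  }

module _ {v k b} {D : SCCD v k b} where

  unchanged-size : ∀ {j S} → Unchanged D j S → ∣ S ∣ ≡ k ∸ 1
  unchanged-size (u-first _ _ ∣S∣) = ∣S∣
  unchanged-size (u-last  _ _ ∣S∣) = ∣S∣
  unchanged-size (u-mid i p refl)  = singleChange D i p

  unchanged-≤ : ∀ {j S} → Unchanged D j S → j ≤ b
  unchanged-≤ (u-first _ _ _) = z≤n
  unchanged-≤ (u-last  _ _ _) = ≤-refl
  unchanged-≤ (u-mid _ p _)   = <⇒≤ p

  -- fromℕ< ignores its proof, so the bounds stored in Unchanged need not be p.
  unchanged-⊆-next : ∀ {j S} → Unchanged D j S → (p : j < b) → S ⊆ block D (fromℕ< p)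
  unchanged-⊆-next (u-first _ S⊆ _) _ = S⊆
  unchanged-⊆-next (u-last  _ _ _)  p = ⊥-elim (<-irrefl refl p)
  unchanged-⊆-next (u-mid _ _ refl) _ = p∩q⊆q _ _

  unchanged-⊆-prev : ∀ {i S} → Unchanged D (suc i) S → (p : i < b) → S ⊆ block D (fromℕ< p)
  unchanged-⊆-prev (u-last _ S⊆ _)  _ = S⊆
  unchanged-⊆-prev (u-mid _ _ refl) _ = p∩q⊆p _ _

¬Unchanged-empty : ∀ {v k j S} {D : SCCD v k 0} → ¬ Unchanged D j S
¬Unchanged-empty (u-first () _ _)
¬Unchanged-empty (u-last  () _ _)
¬Unchanged-empty (u-mid _ () _)

module Extension {v m n : ℕ} (D : SCCD v (suc (suc m)) (suc n)) (E : ExpansionSet D)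
                 (a₀ : Fin (ExpansionSet.size E)) where

  open ExpansionSet E

  AtEnd : Set
  AtEnd = index a₀ ≡ 0 ⊎ index a₀ ≡ suc n

  R : Subset (v + 2) → Subset (v + 2) → Set
  R = Adjacent (suc (suc m))

  ∣subset∣ : ∀ a → ∣ subset a ∣ ≡ suc m
  ∣subset∣ a = unchanged-size (isUnch a)

  subset-⊆-next : ∀ a {j} → index a ≡ j → (p : j < suc n) → subset a ⊆ block D (fromℕ< p)
  subset-⊆-next a refl = unchanged-⊆-next (isUnch a)

  subset-⊆-prev : ∀ a {i} → index a ≡ suc i → (p : i < suc n) → subset a ⊆ block D (fromℕ< p)
  subset-⊆-prev a ia = unchanged-⊆-prev (subst (λ j → Unchanged D j (subset a)) ia (isUnch a))

  lifted : Fin (suc n) → Subset (v + 2)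
  lifted i = block D i ++ᵛ ⊥

  with∞ : Fin 2 → Fin size → Subset (v + 2)
  with∞ i a = subset a ++ᵛ ⁅ i ⁆

  pair : Fin size → List (Subset (v + 2))
  pair a = with∞ zero a ∷ with∞ (suc zero) a ∷ []

  W : Subset v
  W = proj₁ (∃⊆-one-smaller (subset a₀) (∣subset∣ a₀))

  W⊆ : W ⊆ subset a₀
  W⊆ = proj₁ (proj₂ (∃⊆-one-smaller (subset a₀) (∣subset∣ a₀)))

  ∣W∣ : ∣ W ∣ ≡ m
  ∣W∣ = proj₂ (proj₂ (∃⊆-one-smaller (subset a₀) (∣subset∣ a₀)))

  both∞ : Subset (v + 2)
  both∞ = W ++ᵛ ⊤

  -- In the paper's 1-based numbering U_j lies between B_j and B_{j+1}, i.e. between block (j - 1)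
  -- and block j here, which is where weave puts gap j.
  gap : ℕ → List (Subset (v + 2))
  gap j = concatMap pair (keyed index j (allFin size))

  front back : AtEnd → List (Subset (v + 2))
  front (inj₁ _) = [ both∞ ]
  front (inj₂ _) = []
  back  (inj₁ _) = []
  back  (inj₂ _) = [ both∞ ]

  extension : AtEnd → List (Subset (v + 2))
  extension side = front side ++ weave (suc n) lifted gap ++ back side

  lifted-adjacent : ∀ i j → Adjacent (suc (suc m)) (block D i) (block D j) → R (lifted i) (lifted j)
  lifted-adjacent i j adj = trans (∣++∩++∣ (block D i) (block D j) ⊥ ⊥) (trans (+-identityʳ _) adj)

  ∣subset∣+0 : ∀ a → ∣ subset a ∣ + 0 ≡ suc m
  ∣subset∣+0 a = trans (+-identityʳ _) (∣subset∣ a)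

  ∣W∣+1 : ∣ W ∣ + 1 ≡ suc m
  ∣W∣+1 = trans (cong (_+ 1) ∣W∣) (+-comm m 1)

  block-pair : ∀ {X} a → subset a ⊆ X → R (X ++ᵛ ⊥) (with∞ zero a)
  block-pair a S⊆X = trans (∣++∩++∣-⊆ʳ ⊥ ⁅ zero ⁆ S⊆X) (∣subset∣+0 a)

  within-pair : ∀ a → R (with∞ zero a) (with∞ (suc zero) a)
  within-pair a = trans (∣++∩++∣-⊆ˡ ⁅ zero ⁆ ⁅ suc zero ⁆ (⊆-refl {x = subset a})) (∣subset∣+0 a)

  pair-block : ∀ {Y} a → subset a ⊆ Y → R (with∞ (suc zero) a) (Y ++ᵛ ⊥)
  pair-block a S⊆Y = trans (∣++∩++∣-⊆ˡ ⁅ suc zero ⁆ ⊥ S⊆Y) (∣subset∣+0 a)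

  both∞-pair : R both∞ (with∞ zero a₀)
  both∞-pair = trans (∣++∩++∣-⊆ˡ ⊤ ⁅ zero ⁆ W⊆) ∣W∣+1

  pair-both∞ : R (with∞ (suc zero) a₀) both∞
  pair-both∞ = trans (∣++∩++∣-⊆ʳ ⁅ suc zero ⁆ ⊤ W⊆) ∣W∣+1

  occupancy : ∀ j → let occupants = keyed index j (allFin size) in
              occupants ≡ [] ⊎ ∃ λ a → occupants ≡ [ a ] × index a ≡ j
  occupancy j = unique-on-key index distinct (filter⁺ (λ a → index a ≟ j) (allFin⁺ size))
                  (all-filter (λ a → index a ≟ j) (allFin size))

  ∈-keyed : ∀ a → a ∈ₗ keyed index (index a) (allFin size)
  ∈-keyed a = ∈-filter⁺ (λ a′ → index a′ ≟ index a) (∈-allFin a) refl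

  gap-linked : ∀ j ys zs → ((∀ a → index a ≢ j) → Linked R (ys ++ zs)) →
               (∀ a → index a ≡ j → Linked R (ys ++ pair a ++ zs)) → Linked R (ys ++ gap j ++ zs)
  gap-linked j ys zs vacant occupied with occupancy j
  ... | inj₁ none = subst (λ as → Linked R (ys ++ concatMap pair as ++ zs)) (sym none)
                      (vacant (λ { a refl → case subst (a ∈ₗ_) none (∈-keyed a) of λ () }))
  ... | inj₂ (a , single , ia) =
    subst (λ as → Linked R (ys ++ concatMap pair as ++ zs)) (sym single) (occupied a ia)

  first-linked : ∀ side → Linked R (front side ++ gap 0 ++ [ lifted zero ])
  first-linked (inj₁ a₀≡0) =
    gap-linked 0 [ both∞ ] [ lifted zero ] (λ vacant → ⊥-elim (vacant a₀ a₀≡0)) occupied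
    where
    occupied : ∀ a → index a ≡ 0 → Linked R (both∞ ∷ pair a ++ [ lifted zero ])
    occupied a ia with distinct (trans ia (sym a₀≡0))
    ... | refl = both∞-pair ∷ within-pair a ∷ pair-block a (subset-⊆-next a ia (s≤s z≤n)) ∷ [-]
  first-linked (inj₂ _) = gap-linked 0 [] [ lifted zero ] (λ _ → [-])
    (λ a ia → within-pair a ∷ pair-block a (subset-⊆-next a ia (s≤s z≤n)) ∷ [-])

  middle-linked : ∀ i (p : suc i < suc n) →
    Linked R (lifted (fromℕ< (<-trans (n<1+n i) p)) ∷ gap (suc i) ++ [ lifted (fromℕ< p) ])
  middle-linked i p = gap-linked (suc i) [ lifted (fromℕ< (<-trans (n<1+n i) p)) ] [ lifted (fromℕ< p) ]
    (λ _ → lifted-adjacent _ _ (singleChange D i p) ∷ [-])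
    (λ a ia → block-pair a (subset-⊆-prev a ia (<-trans (n<1+n i) p)) ∷ within-pair a
              ∷ pair-block a (subset-⊆-next a ia p) ∷ [-])

  last-linked : ∀ side → Linked R (lifted (fromℕ< (n<1+n n)) ∷ gap (suc n) ++ back side)
  last-linked (inj₁ _) = gap-linked (suc n) [ lifted (fromℕ< (n<1+n n)) ] [] (λ _ → [-])
    (λ a ia → block-pair a (subset-⊆-prev a ia (n<1+n n)) ∷ within-pair a ∷ [-])
  last-linked (inj₂ a₀≡1+n) = gap-linked (suc n) [ lifted (fromℕ< (n<1+n n)) ] [ both∞ ]
    (λ vacant → ⊥-elim (vacant a₀ a₀≡1+n)) occupied
    where
    occupied : ∀ a → index a ≡ suc n → Linked R (lifted (fromℕ< (n<1+n n)) ∷ pair a ++ [ both∞ ])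
    occupied a ia with distinct (trans ia (sym a₀≡1+n))
    ... | refl = block-pair a (subset-⊆-prev a ia (n<1+n n)) ∷ within-pair a ∷ pair-both∞ ∷ [-]

  extension-linked : ∀ side → Linked R (extension side)
  extension-linked side =
    linked-weave n {lifted} {gap} (front side) (back side) (first-linked side) middle-linked (last-linked side)

  extension-sizes : ∀ side → All (λ B → ∣ B ∣ ≡ suc (suc m)) (extension side)
  extension-sizes side =
    ++⁺ (proj₁ (ends side)) (++⁺ (all-weave (suc n) {lifted} {gap} lifted-size gap-sizes) (proj₂ (ends side)))
    where
    lifted-size : ∀ i → ∣ lifted i ∣ ≡ suc (suc m)
    lifted-size i = trans (∣++∣ (block D i) ⊥) (trans (+-identityʳ _) (blockSize D i))

    with∞-size : ∀ i a → ∣ with∞ i a ∣ ≡ suc (suc m)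
    with∞-size i a =
      trans (∣++∣ (subset a) ⁅ i ⁆) (trans (cong₂ _+_ (∣subset∣ a) (∣⁅x⁆∣≡1 i)) (+-comm (suc m) 1))

    pair-sizes : ∀ a → All (λ B → ∣ B ∣ ≡ suc (suc m)) (pair a)
    pair-sizes a = with∞-size zero a ∷ with∞-size (suc zero) a ∷ []

    gap-sizes : ∀ j → All (λ B → ∣ B ∣ ≡ suc (suc m)) (gap j)
    gap-sizes j = concat⁺ (map⁺ {f = pair} (universal pair-sizes (keyed index j (allFin size))))

    both∞-size : ∣ both∞ ∣ ≡ suc (suc m)
    both∞-size = trans (∣++∣ W ⊤) (trans (cong (_+ 2) ∣W∣) (+-comm m 2))

    ends : ∀ side → All (λ B → ∣ B ∣ ≡ suc (suc m)) (front side)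
                  × All (λ B → ∣ B ∣ ≡ suc (suc m)) (back side)
    ends (inj₁ _) = both∞-size ∷ [] , []
    ends (inj₂ _) = [] , both∞-size ∷ []

  ∈-extension : ∀ side {B} → B ∈ₗ weave (suc n) lifted gap → B ∈ₗ extension side
  ∈-extension side B∈ = ∈-++⁺ʳ (front side) (∈-++⁺ˡ B∈)

  both∞-∈-extension : ∀ side → both∞ ∈ₗ extension side
  both∞-∈-extension (inj₁ _) = here refl
  both∞-∈-extension (inj₂ _) = ∈-++⁺ʳ (weave (suc n) lifted gap) (here refl)

  with∞-∈-gap : ∀ i a → with∞ i a ∈ₗ gap (index a)
  with∞-∈-gap i a = ∈-concat⁺′ (∈-pair i) (∈-map⁺ pair (∈-keyed a))
    where
    ∈-pair : ∀ i → with∞ i a ∈ₗ pair a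
    ∈-pair zero       = here refl
    ∈-pair (suc zero) = there (here refl)

  Covered : List (Subset (v + 2)) → Fin (v + 2) → Fin (v + 2) → Set
  Covered L p q = Any (λ B → p ∈ B × q ∈ B) L

  old-new-covered : ∀ side x i → Covered (extension side) (x ↑ˡ 2) (v ↑ʳ i)
  old-new-covered side x i with covers x
  ... | a , x∈a =
    lose (∈-extension side (∈-weave-gap (suc n) lifted gap (unchanged-≤ (isUnch a)) (with∞-∈-gap i a)))
         (↑ˡ-∈ ⁅ i ⁆ x∈a , ↑ʳ-∈ (subset a) (x∈⁅x⁆ i))

  extension-covers : ∀ side p q → p ≢ q → Covered (extension side) p q
  extension-covers side p q p≢q with point v p | point v q
  ... | old x | old y with covering D x y (p≢q ∘ cong (_↑ˡ 2))
  ...   | i , x∈Bᵢ , y∈Bᵢ =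
    lose (∈-extension side (∈-weave-block (suc n) lifted gap i)) (↑ˡ-∈ ⊥ x∈Bᵢ , ↑ˡ-∈ ⊥ y∈Bᵢ)
  extension-covers side p q p≢q | old x | new i = old-new-covered side x i
  extension-covers side p q p≢q | new i | old x = Any.map swap (old-new-covered side x i)
  extension-covers side p q p≢q | new i | new j =
    lose (both∞-∈-extension side) (↑ʳ-∈ W ∈⊤ , ↑ʳ-∈ W ∈⊤)

  length-concatMap-pair : ∀ as → length (concatMap pair as) ≡ 2 * length as
  length-concatMap-pair []       = refl
  length-concatMap-pair (a ∷ as) =
    trans (cong (λ l → 2 + l) (length-concatMap-pair as)) (sym (*-suc 2 (length as)))

  sum-length-gaps : sum (applyUpTo (length ∘ gap) (suc (suc n))) ≡ 2 * size
  sum-length-gaps = begin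
      sum (applyUpTo (length ∘ gap) (suc (suc n)))
    ≡⟨ sum-length-concatMap-keyed index pair (suc (suc n)) (allFin size)
         (All.tabulate (λ {a} _ → s≤s (unchanged-≤ (isUnch a)))) ⟩
      length (concatMap pair (allFin size))
    ≡⟨ length-concatMap-pair (allFin size) ⟩
      2 * length (allFin size)
    ≡⟨ cong (2 *_) (length-tabulate {n = size} id) ⟩
      2 * size
    ∎
    where open ≡-Reasoning

  length-extension : ∀ side → length (extension side) ≡ suc n + 2 * size + 1
  length-extension side = begin
      length (front side ++ weave (suc n) lifted gap ++ back side)
    ≡⟨ length-ends side ⟩
      length (weave (suc n) lifted gap) + 1
    ≡⟨ cong (_+ 1) (length-weave (suc n) lifted gap) ⟩
      suc n + sum (applyUpTo (length ∘ gap) (suc (suc n))) + 1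
    ≡⟨ cong (λ s → suc n + s + 1) sum-length-gaps ⟩
      suc n + 2 * size + 1
    ∎
    where
    open ≡-Reasoning
    length-ends : ∀ side {xs} → length (front side ++ xs ++ back side) ≡ length xs + 1
    length-ends (inj₁ _) {xs} = trans (cong (suc ∘ length) (++-identityʳ xs)) (+-comm 1 (length xs))
    length-ends (inj₂ _) {xs} = length-++ xs

  extended : AtEnd → SCCD (v + 2) (suc (suc m)) (suc n + 2 * size + 1)
  extended side = subst (SCCD (v + 2) (suc (suc m))) (length-extension side)
    (fromLinked (extension side) (extension-linked side) (extension-sizes side) (extension-covers side))

suc-C-2 : ∀ n → suc n C 2 ≡ n + n C 2
suc-C-2 n = trans (sym (nCk+nC[k+1]≡[n+1]C[k+1] n 1)) (cong (_+ n C 2) (nC1≡n n))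

+2-C-2 : ∀ v → (v + 2) C 2 ≡ v C 2 + (2 * v + 1)
+2-C-2 v = begin
    (v + 2) C 2                ≡⟨ cong (_C 2) (+-comm v 2) ⟩
    suc (suc v) C 2            ≡⟨ suc-C-2 (suc v) ⟩
    suc v + suc v C 2          ≡⟨ cong (λ x → suc v + x) (suc-C-2 v) ⟩
    suc v + (v + v C 2)        ≡⟨ rearrange v (v C 2) ⟩
    v C 2 + (2 * v + 1)        ∎
  where
  open ≡-Reasoning
  rearrange : ∀ v c → suc v + (v + c) ≡ c + (2 * v + 1)
  rearrange = ℕ-Solver.solve-∀

excess-extension : ∀ m b F → let v = F * suc m in
  excess (v + 2) (suc (suc m)) (b + 2 * F + 1) ≡ excess v (suc (suc m)) b ℤ.+ + m
excess-extension m b F = begin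
    + (suc m * (b + 2 * F + 1) + c) - + ((v + 2) C 2)
  ≡⟨ cong₂ (λ p q → + p - + q) (expand m b F c) (+2-C-2 v) ⟩
    + (suc m * b + c + (2 * v + 1) + m) - + (v C 2 + (2 * v + 1))
  ≡⟨ cancel (suc m * b + c) (2 * v + 1) m (v C 2) ⟩
    + (suc m * b + c) - + (v C 2) ℤ.+ + m
  ∎
  where
  open ≡-Reasoning
  v c : ℕ
  v = F * suc m
  c = suc m C 2
  expand : ∀ m b F c → suc m * (b + 2 * F + 1) + c ≡ suc m * b + c + (2 * (F * suc m) + 1) + m
  expand = ℕ-Solver.solve-∀
  cancel : ∀ a d m e → + (a + d + m) - + (e + d) ≡ + a - + e ℤ.+ + m
  cancel a d m e rewrite pos-+ (a + d) m | pos-+ a d | pos-+ e d = cancelℤ (+ a) (+ d) (+ m) (+ e)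
    where
    cancelℤ : ∀ a d m e → a ℤ.+ d ℤ.+ m - (e ℤ.+ d) ≡ a - e ℤ.+ m
    cancelℤ = ℤ-Solver.solve-∀

double-/ : ∀ F m v → F * suc m ≡ v → (2 * v) / suc m ≡ 2 * F
double-/ F m v refl = trans (cong (_/ suc m) (sym (*-assoc 2 F (suc m)))) (m*n/n≡m (2 * F) (suc m))

theorem4 : ∀ (v k b : ℕ) .{{_ : NonZero (k ∸ 1)}} (D : SCCD v k b) →
    Σ (ExpansionSet D) Outer →
    SCCD (v + 2) k (b + (2 * v) / (k ∸ 1) + 1)
      × excess (v + 2) k (b + (2 * v) / (k ∸ 1) + 1) ≡ excess v k b ℤ.+ + (k ∸ 2)
theorem4 v zero          b       {{()}} _ _
theorem4 v (suc zero)    b       {{()}} _ _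
theorem4 v (suc (suc m)) zero    D (E , a₀ , _)     =
  ⊥-elim (¬Unchanged-empty (ExpansionSet.isUnch E a₀))
theorem4 v (suc (suc m)) (suc n) D (E , a₀ , outer)
  rewrite double-/ (ExpansionSet.size E) m v (ExpansionSet.sizeEq E) =
  Extension.extended D E a₀ outer , subst excess-grows sizeEq (excess-extension m (suc n) size)
  where
  open ExpansionSet E
  excess-grows : ℕ → Set
  excess-grows v =
    excess (v + 2) (suc (suc m)) (suc n + 2 * size + 1) ≡ excess v (suc (suc m)) (suc n) ℤ.+ + m
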